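{- Let $G$ be a graph and let $H_G$ be the graph constructed as follows: take $12$ vertex-disjoint copies of $G$, denoted $G^z_{ij}$ for $1\le i<j\le 4$ and $z\in\{a,b\}$, together with four new vertices $v_1,v_2,v_3,v_4$; for every $1\le i<j\le 4$ and $z\in\{a,b\}$, join both $v_i$ and $v_j$ to every vertex of $G^z_{ij}$. The edges of $H_G$ are exactly the edges inside the copies and these added edges. Then $G$ is $1$-CFCN$^*$-choosable if and only if $H_G$ is $2$-CFCN$^*$-choosable.
   Context: Graphs are finite, simple, undirected. For a list assignment $\mathcal{L}=\{L_v\}$, an $\mathcal{L}$-CFCN$^*$-coloring of a graph $G$ is a map $f:V'\to\bigcup_{v\in V'}L_v$ on some subset $V'\subseteq V(G)$ with $f(v)\in L_v$ for $v\in V'$, such that every vertex $v\in V(G)$ has a color appearing on exactly one vertex of its closed neighborhood $N_G[v]=N_G(v)\cup\{v\}$. $G$ is $k$-CFCN$^*$-choosable if such a coloring exists for every assignment with $|L_v|=k$ for all $v$. -}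

module Defs where

open import Data.Nat using (ℕ)
open import Data.Fin using (Fin; _<_)
open import Data.Bool using (Bool)
open import Data.Maybe using (Maybe; just)
open import Data.List using (List; length)
open import Data.List.Membership.Propositional using (_∈_)
open import Data.List.Relation.Unary.Unique.Propositional using (Unique)
open import Data.Product using (Σ; ∃; ∃-syntax; _×_; _,_; proj₁; proj₂)
open import Data.Sum using (_⊎_; inj₁; inj₂)
open import Data.Empty using (⊥)
open import Relation.Nullary using (¬_)
open import Relation.Binary.PropositionalEquality using (_≡_; refl)
open import Function.Bundles using (_↔_)

record Graph : Set₁ where
  field
    V     : Set
    E     : V → V → Set
    sym   : ∀ {x y} → E x y → E y x
    irrefl : ∀ {x} → ¬ E x x
open Graph public

Finite : Set → Set
Finite A = ∃[ m ] (A ↔ Fin m)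

ClosedNbr : (G : Graph) → V G → V G → Set
ClosedNbr G v u = u ≡ v ⊎ E G v u

record ListAssignment (G : Graph) (k : ℕ) : Set where
  field
    L      : V G → List ℕ
    size   : ∀ v → length (L v) ≡ k
    unique : ∀ v → Unique (L v)
open ListAssignment public

-- partial colouring f : V' → ⋃ L_v, encoded as V → Maybe ℕ
-- (V' = vertices with f v = just _), respecting the lists
IsCFCNStarColoring : (G : Graph) {k : ℕ} → ListAssignment G k → (V G → Maybe ℕ) → Set
IsCFCNStarColoring G 𝓛 f =
  (∀ v c → f v ≡ just c → c ∈ L 𝓛 v) ×
  (∀ v → ∃[ c ] ∃[ u ] (ClosedNbr G v u × f u ≡ just c ×
          (∀ w → ClosedNbr G v w → f w ≡ just c → w ≡ u)))

CFCNStarChoosable : ℕ → Graph → Set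
CFCNStarChoosable k G =
  (𝓛 : ListAssignment G k) → ∃[ f ] IsCFCNStarColoring G 𝓛 f

-- Construction of H_G
-- index pairs (i , j) with i < j in Fin 4 (i.e. 1 ≤ i < j ≤ 4)
Pair : Set
Pair = Σ (Fin 4 × Fin 4) (λ ij → proj₁ ij < proj₂ ij)

-- copy index (i j, z), z ∈ {a , b} encoded as Bool
Copy : Set
Copy = Pair × Bool

HV : Graph → Set
HV G = Fin 4 ⊎ (Copy × V G)

HE : (G : Graph) → HV G → HV G → Set
HE G (inj₁ _) (inj₁ _) = ⊥
HE G (inj₁ i) (inj₂ ((((a , b) , _) , _) , _)) = i ≡ a ⊎ i ≡ b
HE G (inj₂ ((((a , b) , _) , _) , _)) (inj₁ i) = i ≡ a ⊎ i ≡ b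
HE G (inj₂ (c , x)) (inj₂ (d , y)) = c ≡ d × E G x y

HE-sym : (G : Graph) → ∀ {x y} → HE G x y → HE G y x
HE-sym G {inj₁ _} {inj₁ _} ()
HE-sym G {inj₁ i} {inj₂ _} e = e
HE-sym G {inj₂ _} {inj₁ i} e = e
HE-sym G {inj₂ _} {inj₂ _} (refl , e) = refl , sym G e

HE-irrefl : (G : Graph) → ∀ {x} → ¬ HE G x x
HE-irrefl G {inj₁ _} ()
HE-irrefl G {inj₂ _} (_ , e) = irrefl G e

H : Graph → Graph
H G = record { V = HV G ; E = HE G ; sym = HE-sym G ; irrefl = HE-irrefl G }

-- 1-CFCN*-choosability is the existence of a perfect code (a vertex set meeting every closed
-- neighbourhood exactly once): colour the code from the lists; conversely, for the constant
-- list {0} the coloured vertices form one.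
-- Given a perfect code of G, colour each hub v_m of H_G from its list. A copy whose two hubs
-- got different colours stays uncoloured, its vertices seeing the lower hub's colour once;
-- otherwise colour the code inside it avoiding the common hub colour.
-- Conversely, colour H_G from the constant lists {0,1}. By pigeonhole two hubs v_i, v_j carry
-- the same colour or are both uncoloured. In the first case no vertex of a copy G^z_ij sees
-- that colour exactly once. In the second, the colour seen once at v_i sits in a copy indexed
-- by some z, so it is absent from G^z'_ij with z' ≠ z, which also lies in N[v_i]. Either way
-- the other colour is seen once at every vertex of that copy, and inside it marks a perfect
-- code of G.

module Submission where

open import Data.Bool using (true; not)
open import Data.Bool.Properties using (not-¬)
open import Data.Empty using (⊥-elim)
open import Data.Fin using (Fin; _<_; zero; suc)
open import Data.Fin.Properties using (pigeonhole; <-irrefl)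
open import Data.List using (List; []; _∷_; length)
open import Data.List.Membership.Propositional using (_∈_)
open import Data.List.Relation.Unary.All using ([]; _∷_)
open import Data.List.Relation.Unary.AllPairs using ([]; _∷_)
open import Data.List.Relation.Unary.Any using (here; there)
open import Data.List.Relation.Unary.Unique.Propositional using (Unique)
open import Data.Maybe using (Maybe; just; nothing)
open import Data.Maybe.Properties using (just-injective; ≡-dec)
open import Data.Nat using (ℕ; zero; suc; _∸_)
open import Data.Nat.Properties using (_≟_; n<1+n)
open import Data.Product using (∃-syntax; _×_; _,_; proj₁; proj₂)
open import Data.Sum using (inj₁; inj₂)
open import Data.Sum.Properties using (inj₁-injective; inj₂-injective)
open import Function.Base using (_∘_)
open import Function.Bundles using (_⇔_; mk⇔)
open import Relation.Nullary using (¬_; Dec; yes; no)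
open import Relation.Nullary.Decidable using (_×-dec_)
open import Relation.Unary using (Decidable)
open import Relation.Binary.PropositionalEquality as ≡ using (_≡_; _≢_; refl; trans; cong; subst)

open import Defs

ExactlyOneInNbd : (G : Graph) → (V G → Set) → V G → Set
ExactlyOneInNbd G S v =
  ∃[ u ] (ClosedNbr G v u × S u × (∀ w → ClosedNbr G v w → S w → w ≡ u))

OccursOnce : (G : Graph) → (V G → Maybe ℕ) → V G → ℕ → Set
OccursOnce G f v c = ExactlyOneInNbd G (λ u → f u ≡ just c) v

twice⇒¬exactlyOne : ∀ G {S v a b} → ClosedNbr G v a → ClosedNbr G v b →
                    S a → S b → a ≢ b → ¬ ExactlyOneInNbd G S v
twice⇒¬exactlyOne _ v~a v~b Sa Sb a≢b (_ , _ , _ , only) =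
  a≢b (trans (only _ v~a Sa) (≡.sym (only _ v~b Sb)))

record PerfectCode (G : Graph) : Set₁ where
  field
    member     : V G → Set
    member?    : Decidable member
    exactlyOne : ∀ v → ExactlyOneInNbd G member v

colourIf : {P : Set} → Dec P → ℕ → Maybe ℕ
colourIf (yes _) c = just c
colourIf (no _)  _ = nothing

colourIf-just : ∀ {P : Set} (p? : Dec P) {c d} → colourIf p? c ≡ just d → P × c ≡ d
colourIf-just (yes p) refl = p , refl

colourIf-yes : ∀ {P : Set} (p? : Dec P) {c} → P → colourIf p? c ≡ just c
colourIf-yes (yes _)  _ = refl
colourIf-yes (no ¬p) p = ⊥-elim (¬p p)

some-∈ : ∀ {k} (l : List ℕ) → length l ≡ suc k → ∃[ c ] c ∈ l
some-∈ (c ∷ _) _ = c , here refl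

other-∈ : (l : List ℕ) → length l ≡ 2 → Unique l → (a : ℕ) → ∃[ c ] (c ∈ l × c ≢ a)
other-∈ (b ∷ c ∷ []) _ ((b≢c ∷ []) ∷ _) a with b ≟ a
... | yes refl = c , there (here refl) , λ c≡b → b≢c (≡.sym c≡b)
... | no b≢a   = b , here refl , b≢a

constantLists : (G : Graph) (l : List ℕ) → Unique l → ListAssignment G (length l)
constantLists G l l! = record { L = λ _ → l ; size = λ _ → refl ; unique = λ _ → l! }

perfectCode⇒choosable : ∀ {G k} → PerfectCode G → CFCNStarChoosable (suc k) G
perfectCode⇒choosable {G} code 𝓛 = colouring , inList , occursOnce
  where
  open PerfectCode code
  listColour : ∀ v → ∃[ c ] c ∈ L 𝓛 v
  listColour v = some-∈ (L 𝓛 v) (size 𝓛 v)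
  colouring : V G → Maybe ℕ
  colouring v = colourIf (member? v) (proj₁ (listColour v))
  inList : ∀ v c → colouring v ≡ just c → c ∈ L 𝓛 v
  inList v c eq = subst (_∈ L 𝓛 v) (proj₂ (colourIf-just (member? v) eq)) (proj₂ (listColour v))
  occursOnce : ∀ v → ∃[ c ] OccursOnce G colouring v c
  occursOnce v with exactlyOne v
  ... | s , v~s , s∈ , only =
    proj₁ (listColour s) , s , v~s , colourIf-yes (member? s) s∈ ,
    λ w v~w eq → only w v~w (proj₁ (colourIf-just (member? w) eq))

choosable₁⇒perfectCode : ∀ {G} → CFCNStarChoosable 1 G → PerfectCode G
choosable₁⇒perfectCode {G} choose with choose (constantLists G (0 ∷ []) ([] ∷ []))
... | f , inList , occursOnce = record
  { member     = λ v → f v ≡ just 0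
  ; member?    = λ v → ≡-dec _≟_ (f v) (just 0)
  ; exactlyOne = exactlyOne
  }
  where
  exactlyOne : ∀ v → OccursOnce G f v 0
  exactlyOne v with occursOnce v
  ... | c , occurrence@(u , _ , fu , _) with inList u c fu
  ...   | here refl = occurrence

low high : Copy → Fin 4
low  (((i , _) , _) , _) = i
high (((_ , j) , _) , _) = j

data CopyNbr (G : Graph) (k : Copy) (x : V G) : HV G → Set where
  at-low  : CopyNbr G k x (inj₁ (low k))
  at-high : CopyNbr G k x (inj₁ (high k))
  inside  : ∀ {y} → ClosedNbr G x y → CopyNbr G k x (inj₂ (k , y))

copyNbr : ∀ G {k x w} → ClosedNbr (H G) (inj₂ (k , x)) w → CopyNbr G k x w
copyNbr _ (inj₁ refl) = inside (inj₁ refl)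
copyNbr _ {w = inj₁ _} (inj₂ (inj₁ refl)) = at-low
copyNbr _ {w = inj₁ _} (inj₂ (inj₂ refl)) = at-high
copyNbr _ {w = inj₂ _} (inj₂ (refl , x~y)) = inside (inj₂ x~y)

fromCopyNbr : ∀ G {k x w} → CopyNbr G k x w → ClosedNbr (H G) (inj₂ (k , x)) w
fromCopyNbr _ at-low                = inj₂ (inj₁ refl)
fromCopyNbr _ at-high               = inj₂ (inj₂ refl)
fromCopyNbr _ (inside (inj₁ refl))  = inj₁ refl
fromCopyNbr _ (inside (inj₂ x~y))   = inj₂ (refl , x~y)

restrict-exactlyOne : ∀ G {S : HV G → Set} {k x} → ¬ S (inj₁ (low k)) → ¬ S (inj₁ (high k)) →
                      ExactlyOneInNbd (H G) S (inj₂ (k , x)) →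
                      ExactlyOneInNbd G (λ y → S (inj₂ (k , y))) x
restrict-exactlyOne G ¬low ¬high (u , x~u , Su , only) with copyNbr G x~u
... | at-low  = ⊥-elim (¬low Su)
... | at-high = ⊥-elim (¬high Su)
... | inside {y} x~y = y , x~y , Su , λ w x~w Sw →
  cong proj₂ (inj₂-injective (only _ (fromCopyNbr G (inside x~w)) Sw))

perfectCode⇒H-choosable₂ : ∀ {G} → PerfectCode G → CFCNStarChoosable 2 (H G)
perfectCode⇒H-choosable₂ {G} code 𝓛 = colouring , inList , occursOnce
  where
  open PerfectCode code
  hubColour : Fin 4 → ℕ
  hubColour m = proj₁ (some-∈ (L 𝓛 (inj₁ m)) (size 𝓛 (inj₁ m)))
  avoiding : ∀ k y → ∃[ c ] (c ∈ L 𝓛 (inj₂ (k , y)) × c ≢ hubColour (low k))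
  avoiding k y = other-∈ (L 𝓛 _) (size 𝓛 _) (unique 𝓛 _) _
  active? : ∀ k y → Dec (hubColour (low k) ≡ hubColour (high k) × member y)
  active? k y = (hubColour (low k) ≟ hubColour (high k)) ×-dec member? y
  colouring : HV G → Maybe ℕ
  colouring (inj₁ m)       = just (hubColour m)
  colouring (inj₂ (k , y)) = colourIf (active? k y) (proj₁ (avoiding k y))
  inList : ∀ v c → colouring v ≡ just c → c ∈ L 𝓛 v
  inList (inj₁ m) c refl = proj₂ (some-∈ (L 𝓛 (inj₁ m)) (size 𝓛 (inj₁ m)))
  inList (inj₂ (k , y)) c eq with colourIf-just (active? k y) eq
  ... | _ , refl = proj₁ (proj₂ (avoiding k y))
  differsFromHubs : ∀ {k y c} → colouring (inj₂ (k , y)) ≡ just c →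
                    c ≢ hubColour (low k) × c ≢ hubColour (high k)
  differsFromHubs {k} {y} eq with colourIf-just (active? k y) eq
  ... | (hubs , _) , refl = let fresh = proj₂ (proj₂ (avoiding k y)) in
                            fresh , λ c≡high → fresh (trans c≡high (≡.sym hubs))
  occursOnce : ∀ v → ∃[ c ] OccursOnce (H G) colouring v c
  occursOnce (inj₁ m) = hubColour m , inj₁ m , inj₁ refl , refl , onlyOne
    where
    onlyOne : ∀ w → ClosedNbr (H G) (inj₁ m) w → colouring w ≡ just (hubColour m) → w ≡ inj₁ m
    onlyOne _ (inj₁ refl) _ = refl
    onlyOne (inj₂ _) (inj₂ (inj₁ refl)) eq = ⊥-elim (proj₁ (differsFromHubs eq) refl)
    onlyOne (inj₂ _) (inj₂ (inj₂ refl)) eq = ⊥-elim (proj₂ (differsFromHubs eq) refl)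
  occursOnce (inj₂ (k , x)) with hubColour (low k) ≟ hubColour (high k)
  ... | no hubs≢ = hubColour (low k) , inj₁ (low k) , fromCopyNbr G at-low , refl , onlyOne
    where
    onlyOne : ∀ w → ClosedNbr (H G) (inj₂ (k , x)) w → colouring w ≡ just (hubColour (low k)) →
             w ≡ inj₁ (low k)
    onlyOne w x~w eq with copyNbr G x~w
    ... | at-low   = refl
    ... | at-high  = ⊥-elim (hubs≢ (≡.sym (just-injective eq)))
    ... | inside _ = ⊥-elim (proj₁ (differsFromHubs eq) refl)
  ... | yes hubs with exactlyOne x
  ...   | s , x~s , s∈ , onlyInG =
    proj₁ (avoiding k s) , inj₂ (k , s) , fromCopyNbr G (inside x~s) , coloured , onlyOne
    where
    coloured : colouring (inj₂ (k , s)) ≡ just (proj₁ (avoiding k s))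
    coloured = colourIf-yes (active? k s) (hubs , s∈)
    onlyOne : ∀ w → ClosedNbr (H G) (inj₂ (k , x)) w → colouring w ≡ just (proj₁ (avoiding k s)) →
             w ≡ inj₂ (k , s)
    onlyOne w x~w eq with copyNbr G x~w
    ... | at-low  = ⊥-elim (proj₁ (differsFromHubs coloured) (≡.sym (just-injective eq)))
    ... | at-high = ⊥-elim (proj₂ (differsFromHubs coloured) (≡.sym (just-injective eq)))
    ... | inside {y} x~y =
      cong (λ y → inj₂ (k , y)) (onlyInG y x~y (proj₂ (proj₁ (colourIf-just (active? k y) eq))))

bits : List ℕ
bits = 0 ∷ 1 ∷ []

1∸n≢n : ∀ n → 1 ∸ n ≢ n
1∸n≢n zero          ()
1∸n≢n (suc zero)    ()
1∸n≢n (suc (suc n)) ()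

bit-≢⇒≡1∸ : ∀ {c e} → c ∈ bits → e ∈ bits → c ≢ e → c ≡ 1 ∸ e
bit-≢⇒≡1∸ (here refl)         (here refl)         c≢e = ⊥-elim (c≢e refl)
bit-≢⇒≡1∸ (here refl)         (there (here refl)) _   = refl
bit-≢⇒≡1∸ (there (here refl)) (here refl)         _   = refl
bit-≢⇒≡1∸ (there (here refl)) (there (here refl)) c≢e = ⊥-elim (c≢e refl)

BitValued : Maybe ℕ → Set
BitValued m = ∀ c → m ≡ just c → c ∈ bits

shade : Maybe ℕ → Fin 3
shade nothing        = zero
shade (just zero)    = suc zero
shade (just (suc _)) = suc (suc zero)

shade-injective : ∀ {a b} → BitValued a → BitValued b → shade a ≡ shade b → a ≡ b
shade-injective {nothing} {nothing} _ _ _ = refl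
shade-injective {just c} {just d} a∈ b∈ eq = cong just (shade-injectiveʲ (a∈ c refl) (b∈ d refl) eq)
  where
  shade-injectiveʲ : ∀ {c d} → c ∈ bits → d ∈ bits → shade (just c) ≡ shade (just d) → c ≡ d
  shade-injectiveʲ (here refl)         (here refl)         _ = refl
  shade-injectiveʲ (there (here refl)) (there (here refl)) _ = refl
  shade-injectiveʲ (here refl) (there (here refl)) ()
  shade-injectiveʲ (there (here refl)) (here refl) ()
shade-injective {nothing} {just zero} _ _ ()
shade-injective {nothing} {just (suc _)} _ _ ()
shade-injective {just zero} {nothing} _ _ ()
shade-injective {just (suc _)} {nothing} _ _ ()

module FromBitColouring {G : Graph} (f : HV G → Maybe ℕ) (bitValued : ∀ v → BitValued (f v))
                        (occursOnce : ∀ v → ∃[ c ] OccursOnce (H G) f v c) where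

  otherColourOnce : ∀ {v e} → e ∈ bits → ¬ OccursOnce (H G) f v e → OccursOnce (H G) f v (1 ∸ e)
  otherColourOnce {v} e∈ ¬once with occursOnce v
  ... | c , occurrence@(u , _ , fu , _)
    with bit-≢⇒≡1∸ (bitValued u c fu) e∈ (λ { refl → ¬once occurrence })
  ...   | refl = occurrence

  copyCode : ∀ k e → e ∈ bits → f (inj₁ (low k)) ≢ just (1 ∸ e) → f (inj₁ (high k)) ≢ just (1 ∸ e) →
             (∀ x → ¬ OccursOnce (H G) f (inj₂ (k , x)) e) → PerfectCode G
  copyCode k e e∈ ¬low ¬high ¬once = record
    { member     = λ y → f (inj₂ (k , y)) ≡ just (1 ∸ e)
    ; member?    = λ y → ≡-dec _≟_ (f (inj₂ (k , y))) (just (1 ∸ e))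
    ; exactlyOne = λ x → restrict-exactlyOne G ¬low ¬high (otherColourOnce e∈ (¬once x))
    }

  hubsColoured : ∀ {i j e} → i < j → f (inj₁ i) ≡ just e → f (inj₁ j) ≡ just e → PerfectCode G
  hubsColoured {i} {j} {e} i<j fi fj =
    copyCode k e (bitValued _ e fi) (otherColour fi) (otherColour fj) λ x →
      twice⇒¬exactlyOne (H G) (fromCopyNbr G at-low) (fromCopyNbr G at-high) fi fj
                        (λ eq → <-irrefl (inj₁-injective eq) i<j)
    where
    k : Copy
    k = ((i , j) , i<j) , true
    otherColour : ∀ {v} → f v ≡ just e → f v ≢ just (1 ∸ e)
    otherColour fv eq = 1∸n≢n e (just-injective (trans (≡.sym eq) fv))

  hubsUncoloured : ∀ {i j} → i < j → f (inj₁ i) ≡ nothing → f (inj₁ j) ≡ nothing → PerfectCode G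
  hubsUncoloured {i} {j} i<j fi fj with occursOnce (inj₁ i)
  ... | c , u , i~u , fu , only = fromWitness u i~u fu only
    where
    uncoloured : ∀ {v c} → f v ≡ nothing → f v ≢ just c
    uncoloured fv eq with trans (≡.sym fv) eq
    ... | ()
    fromWitness : ∀ u → ClosedNbr (H G) (inj₁ i) u → f u ≡ just c →
                  (∀ w → ClosedNbr (H G) (inj₁ i) w → f w ≡ just c → w ≡ u) → PerfectCode G
    fromWitness _ (inj₁ refl) fu _ = ⊥-elim (uncoloured fi fu)
    fromWitness (inj₂ ((_ , z) , _)) (inj₂ _) fu only =
      copyCode k c (bitValued _ c fu) (uncoloured fi) (uncoloured fj) absent
      where
      k : Copy
      k = ((i , j) , i<j) , not z
      absent : ∀ x → ¬ OccursOnce (H G) f (inj₂ (k , x)) c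
      absent x (w , x~w , fw , _) with copyNbr G x~w
      ... | at-low  = uncoloured fi fw
      ... | at-high = uncoloured fj fw
      ... | inside _ = not-¬ refl (≡.sym (cong (proj₂ ∘ proj₁) (inj₂-injective
                         (only _ (inj₂ (inj₁ refl)) fw))))

  equalHubs⇒perfectCode : ∀ {i j} → i < j → f (inj₁ i) ≡ f (inj₁ j) → PerfectCode G
  equalHubs⇒perfectCode {i} i<j same with f (inj₁ i) in fi
  ... | nothing = hubsUncoloured i<j fi (≡.sym same)
  ... | just _  = hubsColoured i<j fi (≡.sym same)

  perfectCode : PerfectCode G
  perfectCode with pigeonhole (n<1+n 3) (shade ∘ f ∘ inj₁)
  ... | i , j , i<j , sameShade =
    equalHubs⇒perfectCode i<j (shade-injective (bitValued _) (bitValued _) sameShade)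

H-choosable₂⇒perfectCode : ∀ {G} → CFCNStarChoosable 2 (H G) → PerfectCode G
H-choosable₂⇒perfectCode {G} choose
  with choose (constantLists (H G) bits (((λ ()) ∷ []) ∷ [] ∷ []))
... | f , bitValued , occursOnce = FromBitColouring.perfectCode f bitValued occursOnce

lemma5 : (G : Graph) → Finite (V G) →
    (CFCNStarChoosable 1 G ⇔ CFCNStarChoosable 2 (H G))
lemma5 G _ = mk⇔ (perfectCode⇒H-choosable₂ ∘ choosable₁⇒perfectCode)
                 (perfectCode⇒choosable ∘ H-choosable₂⇒perfectCode)
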